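{- Let $n \ge 1$ and let $f, g \in \mathbb{F}_2[x]$ be coprime polynomials, both of degree $n$. Run Euclid's algorithm on $(f,g)$: set $r_1 = f$, $r_2 = g$ and, for $i = 1, 2, \ldots$, write $r_i = q_i r_{i+1} + r_{i+2}$ with $\deg r_{i+2} < \deg r_{i+1}$ (Euclidean division in $\mathbb{F}_2[x]$), stopping at the index $m$ for which $r_{m+1} = 1$ and $r_{m+2} = 0$ (so $m \ge 2$ and $q_1 = 1$). Let $s_i \in \mathbb{F}_2$ denote the constant term of the quotient $q_i$. Then both $f$ and $g$ have nonzero constant term if and only if the binary word $s_m s_{m-1} \cdots s_2$ (the constant terms of the quotients in the order in which they are used by the reverse of Euclid's algorithm starting from the pair $(1,0)$, with the last quotient $q_1 = 1$ omitted) belongs to the regular language over the alphabet $\{0,1\}$ given by the regular expression $$L_r = \bigl(0(0+1) + 10^*1(0+1)\bigr)^* .$$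
   Context: The reverse of Euclid's algorithm ("dilcuE's algorithm") reconstructs $(f,g)$ from the final pair $(r_{m+1}, r_{m+2}) = (1,0)$ by applying the quotients $q_m, q_{m-1}, \ldots, q_1$ in this order via $r_i = q_i r_{i+1} + r_{i+2}$. In the regular expression, $+$ denotes union, juxtaposition denotes concatenation, and $^*$ denotes Kleene star. -}

module Defs where

open import Data.Bool using (Bool; true; false; _xor_; if_then_else_)
open import Data.List using (List; []; _∷_; _++_; length)
open import Data.Maybe using (Maybe; just; nothing)
open import Data.Nat using (ℕ; zero; suc; _<_; _≤_)
open import Data.Product using (∃; _×_; _,_)
open import Data.Unit using (⊤)
open import Data.Empty using (⊥)
open import Relation.Binary.PropositionalEquality using (_≡_)

-- Polynomials over F₂ = Bool (true = 1, false = 0, + = xor, * = ∧),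
-- as coefficient lists, lowest degree first.  Trailing zeros allowed;
-- equality of polynomials is equality after normalisation.
Poly : Set
Poly = List Bool

norm : Poly → Poly
norm [] = []
norm (b ∷ p) with norm p
... | [] = if b then true ∷ [] else []
... | c ∷ cs = b ∷ c ∷ cs

_≈ₚ_ : Poly → Poly → Set
p ≈ₚ q = norm p ≡ norm q

infix 4 _≈ₚ_

0ₚ 1ₚ : Poly
0ₚ = []
1ₚ = true ∷ []

_+ₚ_ : Poly → Poly → Poly
[] +ₚ q = q
(a ∷ p) +ₚ [] = a ∷ p
(a ∷ p) +ₚ (b ∷ q) = (a xor b) ∷ (p +ₚ q)

_*ₚ_ : Poly → Poly → Poly
[] *ₚ q = []
(a ∷ p) *ₚ q = (if a then q else []) +ₚ (false ∷ (p *ₚ q))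

infixl 6 _+ₚ_
infixl 7 _*ₚ_

-- degree; nothing encodes deg 0 = -∞
deg : Poly → Maybe ℕ
deg p with norm p
... | [] = nothing
... | _ ∷ cs = just (length cs)

data _<ᵈ_ : Maybe ℕ → Maybe ℕ → Set where
  -∞<n : ∀ {n} → nothing <ᵈ just n
  n<m  : ∀ {n m} → n < m → just n <ᵈ just m

const : Poly → Bool
const [] = false
const (b ∷ _) = b

_∣ₚ_ : Poly → Poly → Set
d ∣ₚ f = ∃ λ c → c *ₚ d ≈ₚ f

-- coprime: every common divisor is a unit (the only unit of F₂[x] is 1)
Coprime : Poly → Poly → Set
Coprime f g = ∀ d → d ∣ₚ f → d ∣ₚ g → d ≈ₚ 1ₚ

record EuclidRun (f g : Poly) (m : ℕ) (q r : ℕ → Poly) : Set where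
  field
    r₁   : r 1 ≈ₚ f
    r₂   : r 2 ≈ₚ g
    step : ∀ i → 1 ≤ i → i ≤ m → r i ≈ₚ q i *ₚ r (suc i) +ₚ r (suc (suc i))
    decr : ∀ i → 1 ≤ i → i ≤ m → deg (r (suc (suc i))) <ᵈ deg (r (suc i))
    last₁ : r (suc m) ≈ₚ 1ₚ
    last₀ : r (suc (suc m)) ≈ₚ 0ₚ

revWord : (ℕ → Poly) → ℕ → List Bool
revWord q zero = []
revWord q (suc zero) = []
revWord q (suc (suc k)) = const (q (suc (suc k))) ∷ revWord q (suc k)

-- Regular expressions over {0,1} (0 = false, 1 = true) and their language
data Regex : Set where
  chr  : Bool → Regex
  _⊕_  : Regex → Regex → Regex
  _·_  : Regex → Regex → Regex
  _⋆   : Regex → Regex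

infixl 6 _⊕_
infixl 7 _·_
infix 8 _⋆

data _∈ᴸ_ : List Bool → Regex → Set where
  chr   : ∀ {b} → (b ∷ []) ∈ᴸ chr b
  inl   : ∀ {w e₁ e₂} → w ∈ᴸ e₁ → w ∈ᴸ (e₁ ⊕ e₂)
  inr   : ∀ {w e₁ e₂} → w ∈ᴸ e₂ → w ∈ᴸ (e₁ ⊕ e₂)
  cat   : ∀ {u v e₁ e₂} → u ∈ᴸ e₁ → v ∈ᴸ e₂ → (u ++ v) ∈ᴸ (e₁ · e₂)
  star0 : ∀ {e} → [] ∈ᴸ (e ⋆)
  starS : ∀ {u v e} → u ∈ᴸ e → v ∈ᴸ (e ⋆) → (u ++ v) ∈ᴸ (e ⋆)

infix 4 _∈ᴸ_

Lr : Regex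
Lr = ((chr false · (chr false ⊕ chr true))
      ⊕ (chr true · (chr false ⋆) · chr true · (chr false ⊕ chr true))) ⋆

-- Reducing rᵢ = qᵢ rᵢ₊₁ + rᵢ₊₂ modulo x gives cᵢ = sᵢ cᵢ₊₁ + cᵢ₊₂ for the constant terms
-- cᵢ of the remainders, so reading sₘ ⋯ s₂ moves the pair (cₘ₊₁, cₘ₊₂) = (1, 0) to (c₂, c₃)
-- through a four-state automaton on F₂ × F₂.  Since deg f = deg g the quotient q₁ is 1,
-- so c₁ = c₂ + c₃, and c₁ = c₂ = 1 holds exactly when (c₂, c₃) = (1, 0).  Finally L_r is
-- precisely the language of words leading the automaton from (1, 0) back to (1, 0):
-- from (1, 0) a 0 leads to (0, 1), a 1 to (1, 1), which is fixed by 0 and left to (0, 1)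
-- by 1, and (0, 1) returns to (1, 0) on either letter.
module Submission where

open import Defs
open import Data.Bool using (Bool; true; false; _xor_; _∧_)
open import Data.Bool.Properties using (xor-identityʳ; ∧-zeroʳ)
open import Data.List using (List; []; _∷_; _++_; length; replicate; foldl)
open import Data.List.Properties using (++-assoc; foldl-++)
open import Data.Maybe using (Maybe; just; nothing)
open import Data.Nat using (ℕ; zero; suc; _≤_; _+_; z≤n; s≤s)
open import Data.Nat.Properties using (≤-trans; ≤-refl; m≤n+m; n≤1+n)
open import Data.Product using (_×_; _,_)
open import Relation.Binary.PropositionalEquality
open import Relation.Nullary using (contradiction)
open import Function.Bundles using (_⇔_; mk⇔)
open import Function.Construct.Symmetry using (⇔-sym)
open import Function.Related.Propositional using (module EquationalReasoning)

coef : Poly → ℕ → Bool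
coef []      _       = false
coef (b ∷ p) zero    = b
coef (b ∷ p) (suc i) = coef p i

const≡coef0 : ∀ p → const p ≡ coef p 0
const≡coef0 []      = refl
const≡coef0 (b ∷ p) = refl

coef-norm : ∀ p i → coef (norm p) i ≡ coef p i
coef-norm []      i = refl
coef-norm (b ∷ p) i with norm p | coef-norm p
coef-norm (true  ∷ p) zero    | []    | _  = refl
coef-norm (false ∷ p) zero    | []    | _  = refl
coef-norm (true  ∷ p) (suc i) | []    | ih = ih i
coef-norm (false ∷ p) (suc i) | []    | ih = ih i
coef-norm (b ∷ p)     zero    | _ ∷ _ | _  = refl
coef-norm (b ∷ p)     (suc i) | _ ∷ _ | ih = ih i

≈ₚ⇒coef≡ : ∀ p q → p ≈ₚ q → ∀ i → coef p i ≡ coef q i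
≈ₚ⇒coef≡ p q p≈q i = begin
  coef p i        ≡⟨ sym (coef-norm p i) ⟩
  coef (norm p) i ≡⟨ cong (λ l → coef l i) p≈q ⟩
  coef (norm q) i ≡⟨ coef-norm q i ⟩
  coef q i        ∎
  where open ≡-Reasoning

const-≈ₚ : ∀ p q → p ≈ₚ q → const p ≡ const q
const-≈ₚ p q p≈q = trans (const≡coef0 p) (trans (≈ₚ⇒coef≡ p q p≈q 0) (sym (const≡coef0 q)))

deg-≈ₚ : ∀ p q → p ≈ₚ q → deg p ≡ deg q
deg-≈ₚ p q p≈q with norm p | norm q | p≈q
... | l | .l | refl = refl

coef-+ₚ : ∀ p q i → coef (p +ₚ q) i ≡ coef p i xor coef q i
coef-+ₚ []      q       i       = refl
coef-+ₚ (a ∷ p) []      i       = sym (xor-identityʳ _)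
coef-+ₚ (a ∷ p) (b ∷ q) zero    = refl
coef-+ₚ (a ∷ p) (b ∷ q) (suc i) = coef-+ₚ p q i

coef-*ₚ : ∀ a p q i → coef ((a ∷ p) *ₚ q) i ≡ (a ∧ coef q i) xor coef (false ∷ p *ₚ q) i
coef-*ₚ true  p q i = coef-+ₚ q (false ∷ p *ₚ q) i
coef-*ₚ false p q i = refl

const-+ₚ : ∀ p q → const (p +ₚ q) ≡ const p xor const q
const-+ₚ []      q       = refl
const-+ₚ (a ∷ p) []      = sym (xor-identityʳ a)
const-+ₚ (a ∷ p) (b ∷ q) = refl

const-*ₚ : ∀ p q → const (p *ₚ q) ≡ const p ∧ const q
const-*ₚ []          q = refl
const-*ₚ (true  ∷ p) q = trans (const-+ₚ q (false ∷ p *ₚ q)) (xor-identityʳ (const q))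
const-*ₚ (false ∷ p) q = refl

VanishesFrom : Poly → ℕ → Set
VanishesFrom p n = ∀ i → n ≤ i → coef p i ≡ false

Leading : Poly → ℕ → Set
Leading p n = coef p n ≡ true × VanishesFrom p (suc n)

Degree : Poly → Maybe ℕ → Set
Degree p nothing  = VanishesFrom p 0
Degree p (just n) = Leading p n

leading-∷ : ∀ {b p n} → Leading p n → Leading (b ∷ p) (suc n)
leading-∷ (top , above) = top , λ { (suc i) (s≤s n<i) → above i n<i }

norm≡[]⇒vanishes : ∀ p → norm p ≡ [] → VanishesFrom p 0
norm≡[]⇒vanishes p eq i _ = trans (sym (coef-norm p i)) (cong (λ l → coef l i) eq)

norm≡∷⇒leading : ∀ p {c cs} → norm p ≡ c ∷ cs → Leading p (length cs)
norm≡∷⇒leading (b ∷ p) eq with norm p in eqₚ | norm≡∷⇒leading p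
norm≡∷⇒leading (true ∷ p) refl | [] | _ =
  refl , λ { zero () ; (suc i) _ → norm≡[]⇒vanishes p eqₚ i z≤n }
norm≡∷⇒leading (b ∷ p) refl | _ ∷ _ | leading-p = leading-∷ (leading-p refl)

degree-deg : ∀ p → Degree p (deg p)
degree-deg p with norm p in eq
... | []    = norm≡[]⇒vanishes p eq
... | _ ∷ _ = norm≡∷⇒leading p eq

deg≡just⇒leading : ∀ p {n} → deg p ≡ just n → Leading p n
deg≡just⇒leading p eq = subst (Degree p) eq (degree-deg p)

<ᵈ⇒vanishesFrom : ∀ p {n} → deg p <ᵈ just n → VanishesFrom p n
<ᵈ⇒vanishesFrom p = below (degree-deg p)
  where
  below : ∀ {d n} → Degree p d → d <ᵈ just n → VanishesFrom p n
  below zero-p        -∞<n      i _   = zero-p i z≤n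
  below (_ , above-k) (n<m k<n) i n≤i = above-k i (≤-trans k<n n≤i)

vanishes-*ₚ : ∀ p q → VanishesFrom p 0 → VanishesFrom (p *ₚ q) 0
vanishes-*ₚ []          q _      i       _ = refl
vanishes-*ₚ (true  ∷ p) q zero-p i       _ with zero-p 0 z≤n
... | ()
vanishes-*ₚ (false ∷ p) q zero-p zero    _ = refl
vanishes-*ₚ (false ∷ p) q zero-p (suc i) _ =
  vanishes-*ₚ p q (λ j _ → zero-p (suc j) z≤n) i z≤n

leading-*ₚ : ∀ p q {a b} → Leading p a → Leading q b → coef (p *ₚ q) (a + b) ≡ true
leading-*ₚ (c ∷ p) q {zero} {b} (refl , above-0) (top-q , _) = begin
  coef ((true ∷ p) *ₚ q) b               ≡⟨ coef-*ₚ true p q b ⟩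
  coef q b xor coef (false ∷ p *ₚ q) b   ≡⟨ cong₂ _xor_ top-q (shifted b) ⟩
  true                                   ∎
  where
  open ≡-Reasoning
  shifted : ∀ i → coef (false ∷ p *ₚ q) i ≡ false
  shifted zero    = refl
  shifted (suc i) = vanishes-*ₚ p q (λ j _ → above-0 (suc j) (s≤s z≤n)) i z≤n
leading-*ₚ (c ∷ p) q {suc a} {b} (top-p , above-p) lead-q@(_ , above-q) = begin
  coef ((c ∷ p) *ₚ q) (suc (a + b))              ≡⟨ coef-*ₚ c p q (suc (a + b)) ⟩
  (c ∧ coef q (suc (a + b))) xor coef (p *ₚ q) (a + b)
    ≡⟨ cong₂ (λ x y → (c ∧ x) xor y) (above-q (suc (a + b)) (s≤s (m≤n+m b a)))
                                        (leading-*ₚ p q (top-p , λ i n<i → above-p (suc i) (s≤s n<i)) lead-q) ⟩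
  (c ∧ false) xor true                           ≡⟨ cong (_xor true) (∧-zeroʳ c) ⟩
  true                                           ∎
  where open ≡-Reasoning

-- Q = 0 would make F vanish at n, and deg Q = d > 0 would give F a nonzero coefficient at d + n.
const-quotient-of-equal-degrees : ∀ F Q G R {n} → Leading F n → Leading G n → VanishesFrom R n →
  F ≈ₚ Q *ₚ G +ₚ R → const Q ≡ true
const-quotient-of-equal-degrees F Q G R {n} (top-F , above-F) lead-G vanish-R F≈QG+R =
  by-degree (deg Q) (degree-deg Q)
  where
  coef-F : ∀ i → coef F i ≡ coef (Q *ₚ G) i xor coef R i
  coef-F i = trans (≈ₚ⇒coef≡ F (Q *ₚ G +ₚ R) F≈QG+R i) (coef-+ₚ (Q *ₚ G) R i)

  by-degree : ∀ d → Degree Q d → const Q ≡ true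
  by-degree nothing zero-Q = contradiction (trans (sym top-F) (begin
    coef F n                      ≡⟨ coef-F n ⟩
    coef (Q *ₚ G) n xor coef R n  ≡⟨ cong₂ _xor_ (vanishes-*ₚ Q G zero-Q n z≤n) (vanish-R n ≤-refl) ⟩
    false                         ∎)) λ ()
    where open ≡-Reasoning
  by-degree (just zero)    (top-Q , _) = trans (const≡coef0 Q) top-Q
  by-degree (just (suc d)) lead-Q      = contradiction (trans (sym (above-F k (s≤s (m≤n+m n d)))) (begin
    coef F k                      ≡⟨ coef-F k ⟩
    coef (Q *ₚ G) k xor coef R k  ≡⟨ cong₂ _xor_ (leading-*ₚ Q G lead-Q lead-G) (vanish-R k (m≤n+m n (suc d))) ⟩
    true                          ∎)) λ ()
    where
    k : ℕ
    k = suc d + n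
    open ≡-Reasoning

-- The pair (cₖ₊₁, cₖ₊₂) of constant terms goes to (cₖ, cₖ₊₁) when qₖ has constant term s.
reverseStep : Bool × Bool → Bool → Bool × Bool
reverseStep (a , b) s = (s ∧ a) xor b , a

oneZero : Bool × Bool
oneZero = true , false

reverseStep-01 : ∀ s → reverseStep (false , true) s ≡ oneZero
reverseStep-01 false = refl
reverseStep-01 true  = refl

Lr-block : Regex
Lr-block = (chr false · (chr false ⊕ chr true))
         ⊕ (chr true · (chr false ⋆) · chr true · (chr false ⊕ chr true))

zeros-fix-11 : ∀ {z} → z ∈ᴸ chr false ⋆ → foldl reverseStep (true , true) z ≡ (true , true)
zeros-fix-11 star0          = refl
zeros-fix-11 (starS chr zs) = zeros-fix-11 zs

one-zeros-one-returns : ∀ {z} → z ∈ᴸ chr false ⋆ → ∀ s →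
  foldl reverseStep oneZero ((((true ∷ []) ++ z) ++ true ∷ []) ++ s ∷ []) ≡ oneZero
one-zeros-one-returns {z} zs s = begin
  foldl reverseStep oneZero ((((true ∷ []) ++ z) ++ true ∷ []) ++ s ∷ [])
    ≡⟨ foldl-++ reverseStep oneZero (((true ∷ []) ++ z) ++ true ∷ []) (s ∷ []) ⟩
  reverseStep (foldl reverseStep oneZero (((true ∷ []) ++ z) ++ true ∷ [])) s
    ≡⟨ cong (λ st → reverseStep st s) (foldl-++ reverseStep oneZero ((true ∷ []) ++ z) (true ∷ [])) ⟩
  reverseStep (reverseStep (foldl reverseStep (true , true) z) true) s
    ≡⟨ cong (λ st → reverseStep (reverseStep st true) s) (zeros-fix-11 zs) ⟩
  reverseStep (false , true) s
    ≡⟨ reverseStep-01 s ⟩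
  oneZero ∎
  where open ≡-Reasoning

block-returns : ∀ {u} → u ∈ᴸ Lr-block → foldl reverseStep oneZero u ≡ oneZero
block-returns (inl (cat chr (inl chr)))                    = refl
block-returns (inl (cat chr (inr chr)))                    = refl
block-returns (inr (cat (cat (cat chr zs) chr) (inl chr))) = one-zeros-one-returns zs false
block-returns (inr (cat (cat (cat chr zs) chr) (inr chr))) = one-zeros-one-returns zs true

∈Lr⇒returns : ∀ {w} → w ∈ᴸ Lr → foldl reverseStep oneZero w ≡ oneZero
∈Lr⇒returns star0                     = refl
∈Lr⇒returns (starS {u} {v} block rest) = begin
  foldl reverseStep oneZero (u ++ v)                 ≡⟨ foldl-++ reverseStep oneZero u v ⟩
  foldl reverseStep (foldl reverseStep oneZero u) v  ≡⟨ cong (λ st → foldl reverseStep st v) (block-returns block) ⟩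
  foldl reverseStep oneZero v                        ≡⟨ ∈Lr⇒returns rest ⟩
  oneZero                                            ∎
  where open ≡-Reasoning

bit∈ : ∀ s → s ∷ [] ∈ᴸ chr false ⊕ chr true
bit∈ false = inl chr
bit∈ true  = inr chr

zeros∈ : ∀ k → replicate k false ∈ᴸ chr false ⋆
zeros∈ zero    = star0
zeros∈ (suc k) = starS chr (zeros∈ k)

zeros-++-false∷ : ∀ k (w : List Bool) → replicate k false ++ false ∷ w ≡ false ∷ replicate k false ++ w
zeros-++-false∷ zero    w = refl
zeros-++-false∷ (suc k) w = cong (false ∷_) (zeros-++-false∷ k w)

one-zeros-one-word : ∀ k s (w : List Bool) →
  ((((true ∷ []) ++ replicate k false) ++ true ∷ []) ++ s ∷ []) ++ w ≡ true ∷ replicate k false ++ true ∷ s ∷ w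
one-zeros-one-word k s w = cong (true ∷_) (trans (++-assoc (replicate k false ++ true ∷ []) (s ∷ []) w)
                                                (++-assoc (replicate k false) (true ∷ []) (s ∷ w)))

mutual
  returns⇒∈Lr : ∀ w → foldl reverseStep oneZero w ≡ oneZero → w ∈ᴸ Lr
  returns⇒∈Lr []                _       = star0
  returns⇒∈Lr (false ∷ [])      ()
  returns⇒∈Lr (false ∷ s ∷ w)   returns =
    starS (inl (cat chr (bit∈ s)))
          (returns⇒∈Lr w (subst (λ st → foldl reverseStep st w ≡ oneZero) (reverseStep-01 s) returns))
  returns⇒∈Lr (true ∷ w)        returns = returns-from-11⇒∈Lr 0 w returns

  returns-from-11⇒∈Lr : ∀ k w → foldl reverseStep (true , true) w ≡ oneZero →
    true ∷ replicate k false ++ w ∈ᴸ Lr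
  returns-from-11⇒∈Lr k []              ()
  returns-from-11⇒∈Lr k (false ∷ w)     returns =
    subst (λ l → true ∷ l ∈ᴸ Lr) (sym (zeros-++-false∷ k w)) (returns-from-11⇒∈Lr (suc k) w returns)
  returns-from-11⇒∈Lr k (true ∷ [])     ()
  returns-from-11⇒∈Lr k (true ∷ s ∷ w)  returns =
    subst (_∈ᴸ Lr) (one-zeros-one-word k s w)
      (starS (inr (cat (cat (cat chr (zeros∈ k)) chr) (bit∈ s)))
             (returns⇒∈Lr w (subst (λ st → foldl reverseStep st w ≡ oneZero) (reverseStep-01 s) returns)))

∈Lr⇔returns : ∀ w → w ∈ᴸ Lr ⇔ foldl reverseStep oneZero w ≡ oneZero
∈Lr⇔returns w = mk⇔ ∈Lr⇒returns (returns⇒∈Lr w)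

both-true⇔oneZero : ∀ c₂ c₃ → ((c₂ xor c₃ ≡ true) × (c₂ ≡ true)) ⇔ ((c₂ , c₃) ≡ oneZero)
both-true⇔oneZero _ _ = mk⇔ to from
  where
  to : ∀ {c₂ c₃} → (c₂ xor c₃ ≡ true) × (c₂ ≡ true) → (c₂ , c₃) ≡ oneZero
  to {true} {false} _ = refl
  to {true} {true} (() , _)
  from : ∀ {c₂ c₃} → (c₂ , c₃) ≡ oneZero → (c₂ xor c₃ ≡ true) × (c₂ ≡ true)
  from refl = refl , refl

module _ {f g m q r} (run : EuclidRun f g m q r) where
  open EuclidRun run

  const-step : ∀ k → 1 ≤ k → k ≤ m →
    const (r k) ≡ (const (q k) ∧ const (r (suc k))) xor const (r (suc (suc k)))
  const-step k 1≤k k≤m = begin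
    const (r k)                                ≡⟨ const-≈ₚ (r k) (q k *ₚ rₖ₊₁ +ₚ rₖ₊₂) (step k 1≤k k≤m) ⟩
    const (q k *ₚ rₖ₊₁ +ₚ rₖ₊₂)                ≡⟨ const-+ₚ (q k *ₚ rₖ₊₁) rₖ₊₂ ⟩
    const (q k *ₚ rₖ₊₁) xor const rₖ₊₂         ≡⟨ cong (_xor const rₖ₊₂) (const-*ₚ (q k) rₖ₊₁) ⟩
    (const (q k) ∧ const rₖ₊₁) xor const rₖ₊₂  ∎
    where
    open ≡-Reasoning
    rₖ₊₁ rₖ₊₂ : Poly
    rₖ₊₁ = r (suc k)
    rₖ₊₂ = r (suc (suc k))

  reverse-run : ∀ k → 1 ≤ k → k ≤ m →
    foldl reverseStep (const (r (suc k)) , const (r (suc (suc k)))) (revWord q k) ≡ (const (r 2) , const (r 3))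
  reverse-run (suc zero)    _   _   = refl
  reverse-run (suc (suc k)) 1≤k k≤m =
    trans (cong (λ c → foldl reverseStep (c , const (r (suc (suc (suc k))))) (revWord q (suc k)))
                (sym (const-step (suc (suc k)) 1≤k k≤m)))
          (reverse-run (suc k) (s≤s z≤n) (≤-trans (n≤1+n _) k≤m))

  reverse-run-from-oneZero : 1 ≤ m → foldl reverseStep oneZero (revWord q m) ≡ (const (r 2) , const (r 3))
  reverse-run-from-oneZero 1≤m = begin
    foldl reverseStep oneZero (revWord q m)
      ≡⟨ cong (λ st → foldl reverseStep st (revWord q m)) (sym (cong₂ _,_ const-1 const-0)) ⟩
    foldl reverseStep (const (r (suc m)) , const (r (suc (suc m)))) (revWord q m)
      ≡⟨ reverse-run m 1≤m ≤-refl ⟩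
    (const (r 2) , const (r 3)) ∎
    where
    open ≡-Reasoning
    const-1 : const (r (suc m)) ≡ true
    const-1 = const-≈ₚ (r (suc m)) 1ₚ last₁
    const-0 : const (r (suc (suc m))) ≡ false
    const-0 = const-≈ₚ (r (suc (suc m))) 0ₚ last₀

  const-q₁ : ∀ {n} → deg f ≡ just n → deg g ≡ just n → 1 ≤ m → const (q 1) ≡ true
  const-q₁ {n} deg-f deg-g 1≤m = const-quotient-of-equal-degrees (r 1) (q 1) (r 2) (r 3)
    (deg≡just⇒leading (r 1) (trans (deg-≈ₚ (r 1) f r₁) deg-f))
    (deg≡just⇒leading (r 2) deg-r₂)
    (<ᵈ⇒vanishesFrom (r 3) (subst (deg (r 3) <ᵈ_) deg-r₂ (decr 1 ≤-refl 1≤m)))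
    (step 1 ≤-refl 1≤m)
    where
    deg-r₂ : deg (r 2) ≡ just n
    deg-r₂ = trans (deg-≈ₚ (r 2) g r₂) deg-g

lemma1 : (n : ℕ) → 1 ≤ n → (f g : Poly) → Coprime f g →
    deg f ≡ just n → deg g ≡ just n →
    (m : ℕ) (q r : ℕ → Poly) → EuclidRun f g m q r →
    ((const f ≡ true) × (const g ≡ true)) ⇔ (revWord q m ∈ᴸ Lr)
lemma1 .(suc _) (s≤s z≤n) f g _ deg-f _ zero q r run
  with trans (sym (deg-≈ₚ (r 1) 1ₚ (EuclidRun.last₁ run))) (trans (deg-≈ₚ (r 1) f (EuclidRun.r₁ run)) deg-f)
... | ()
lemma1 n _ f g _ deg-f deg-g (suc m) q r run = begin
  ((const f ≡ true) × (const g ≡ true))    ≡⟨ cong₂ (λ a b → (a ≡ true) × (b ≡ true)) const-f const-g ⟩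
  ((c₂ xor c₃ ≡ true) × (c₂ ≡ true))      ∼⟨ both-true⇔oneZero c₂ c₃ ⟩
  ((c₂ , c₃) ≡ oneZero)                   ≡⟨ cong (_≡ oneZero) (sym (reverse-run-from-oneZero run (s≤s z≤n))) ⟩
  (foldl reverseStep oneZero w ≡ oneZero)  ∼⟨ ⇔-sym (∈Lr⇔returns w) ⟩
  (w ∈ᴸ Lr)                               ∎
  where
  open EuclidRun run
  open EquationalReasoning
  w : List Bool
  w = revWord q (suc m)
  c₂ c₃ : Bool
  c₂ = const (r 2)
  c₃ = const (r 3)

  const-f : const f ≡ c₂ xor c₃
  const-f = trans (sym (const-≈ₚ (r 1) f r₁))
                  (trans (const-step run 1 ≤-refl (s≤s z≤n))
                         (cong (λ s → (s ∧ c₂) xor c₃) (const-q₁ run deg-f deg-g (s≤s z≤n))))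

  const-g : const g ≡ c₂
  const-g = sym (const-≈ₚ (r 2) g r₂)
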